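{- Let $a,b,p,q\in\mathbb{Z}$, let $(h_n)$ be defined by $h_0=a$, $h_1=b$, $h_n=ph_{n-1}+qh_{n-2}$ for $n\ge 2$, let $n\ge 1$ and $\mathbf{h}=(h_0,\dots,h_{n-1})$. If $$\sum_{i=0}^{n-1}h_i\,h_{(i+j-1)_n}\ge 0\quad\text{for all } j=1,\dots,n,$$ then $$\|\mathbf{C}(\mathbf{h})\|=|h_0+\dots+h_{n-1}|,$$ where: if $p+q\ne 1$, then $h_0+\dots+h_{n-1}=\dfrac{h_n+qh_{n-1}+(p-1)a-b}{p+q-1}$; if $p+q=1$ and $p\ne 2$, then $h_0+\dots+h_{n-1}=\dfrac{qh_{n-1}+(n-1)(qa+b)+a}{q+1}$; if $p=2$ and $q=-1$, then $h_0+\dots+h_{n-1}=n\,\dfrac{h_{n-1}+a}{2}$.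
   Context: For $m\in\mathbb{Z}$, $m_n=m-\lfloor m/n\rfloor n$ (the least nonnegative residue of $m$ modulo $n$). For $\mathbf{x}=(x_0,\dots,x_{n-1})\in\mathbb{R}^n$, the circulant matrix $\mathbf{C}(\mathbf{x})$ is the $n\times n$ matrix whose first row is $(x_0,x_1,\dots,x_{n-1})$ and each subsequent row is the cyclic right shift of the previous one; i.e. its $(r,c)$ entry ($r,c=1,\dots,n$) is $x_{(c-r) \bmod n}$. $\|\cdot\|$ denotes the spectral norm. -}

module Defs where

open import Data.Nat as ℕ using (ℕ; zero; suc; NonZero)
open import Data.Nat.DivMod using (_%_)
open import Data.Fin as F using (Fin; toℕ)
open import Data.Fin.Properties using ()
open import Data.Integer using (ℤ; _+_; _*_; _-_; _≤_; ∣_∣; +_)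
open import Data.Product using (∃; _×_)
open import Relation.Binary.PropositionalEquality using (_≡_)
open import Relation.Nullary using (¬_)

∑ : (n : ℕ) → (Fin n → ℤ) → ℤ
∑ zero    f = + 0
∑ (suc n) f = f F.zero + ∑ n (λ i → f (F.suc i))

hseq : (a b p q : ℤ) → ℕ → ℤ
hseq a b p q zero = a
hseq a b p q (suc zero) = b
hseq a b p q (suc (suc n)) = p * hseq a b p q (suc n) + q * hseq a b p q n

-- Circulant matrix C(x), 0-indexed rows r and columns c: entry x_{(c - r) mod n}
circulant : (n : ℕ) .{{_ : NonZero n}} → (Fin n → ℤ) → Fin n → Fin n → ℤ
circulant n x r c = x (F.fromℕ< (Data.Nat.DivMod.m%n<n (toℕ c ℕ.+ (n ℕ.∸ toℕ r)) n))

_·ᵥ_ : {n : ℕ} → (Fin n → Fin n → ℤ) → (Fin n → ℤ) → Fin n → ℤ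
_·ᵥ_ {n} A x r = ∑ n (λ c → A r c * x c)

‖_‖² : {n : ℕ} → (Fin n → ℤ) → ℤ
‖_‖² {n} x = ∑ n (λ i → x i * x i)

-- Spectral norm of an integer matrix A equals the nonnegative integer s:
-- ‖A‖ = max_{x ≠ 0} ‖Ax‖/‖x‖ = s, stated squared:
-- every x satisfies ‖Ax‖² ≤ s²‖x‖², and the bound is attained by some x ≠ 0.
SpectralNormIs : {n : ℕ} → (Fin n → Fin n → ℤ) → ℕ → Set
SpectralNormIs {n} A s =
  (∀ (x : Fin n → ℤ) → ‖ A ·ᵥ x ‖² ≤ (+ s) * (+ s) * ‖ x ‖²)
  × ∃ (λ (x : Fin n → ℤ) → ¬ (‖ x ‖² ≡ + 0) × ‖ A ·ᵥ x ‖² ≡ (+ s) * (+ s) * ‖ x ‖²)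

-- For any square matrix A, ‖A x‖² = xᵀ (AᵀA) x. For the circulant A = C(h) every row and
-- every column sums to S = h₀ + ⋯ + h_{n-1}, so every row of the Gram matrix AᵀA sums to S²;
-- moreover the entries of AᵀA are the cyclic autocorrelations Σᵢ hᵢ h_{(i+j-1)_n}, which the
-- hypothesis makes nonnegative. For a nonnegative symmetric matrix M with row sums s,
-- summing 2 x_c x_d M_cd ≤ (x_c² + x_d²) M_cd gives xᵀ M x ≤ s ‖x‖², so ‖A x‖ ≤ |S| ‖x‖,
-- with equality at the all-ones vector.
-- The closed forms for S follow by induction from the recurrence: (p + q - 1) S telescopes
-- for all p, q; when p + q = 1 the quantity h_{k+1} + q h_k is constant; and for
-- (p, q) = (2, -1) the sequence is an arithmetic progression.

module Submission where

open import Defs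
open import Data.Nat as ℕ using (ℕ; NonZero; _∸_; _%_)
open import Data.Fin using (Fin; toℕ)
open import Data.Integer using (ℤ; _+_; _*_; _-_; _≤_; ∣_∣; +_; -_)
open import Data.Product using (_×_)
open import Relation.Binary.PropositionalEquality using (_≡_; _≢_)

open import Data.Nat using (zero; suc; s≤s; z≤n)
import Data.Nat.Properties as ℕP
open import Data.Nat.DivMod using (m%n<n; m<n⇒m%n≡m; [m+n]%n≡m%n; m%n%n≡m%n; %-distribˡ-+)
open import Data.Fin as Fin using (fromℕ<)
open import Data.Fin.Properties using (toℕ<n; toℕ-fromℕ<; fromℕ<-cong; fromℕ<-toℕ)
open import Data.Integer using (-[1+_]; +≤+; nonNegative)
open import Data.Integer.Properties as ℤP using (+-*-semiring; +-0-abelianGroup)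
open import Data.Integer.Tactic.RingSolver using (solve-∀)
open import Data.Product using (_,_)
open import Function using (_∘_)
open import Relation.Binary.PropositionalEquality using (refl; sym; trans; cong; cong₂; subst; subst₂; module ≡-Reasoning)

open import Algebra.Properties.Semiring.Sum +-*-semiring
  using (sum; sum-syntax; sum-cong-≗; ∑-comm; ∑-distrib-+; *-distribˡ-sum; *-distribʳ-sum)
open import Algebra.Properties.AbelianGroup +-0-abelianGroup using (∙-cancelˡ)

∑≡sum : ∀ n (f : Fin n → ℤ) → ∑ n f ≡ sum f
∑≡sum zero    f = refl
∑≡sum (suc n) f = cong (_+_ (f Fin.zero)) (∑≡sum n (f ∘ Fin.suc))

∑-mono-≤ : ∀ {n} {f g : Fin n → ℤ} → (∀ i → f i ≤ g i) → sum f ≤ sum g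
∑-mono-≤ {zero}  _   = ℤP.≤-refl
∑-mono-≤ {suc n} f≤g = ℤP.+-mono-≤ (f≤g Fin.zero) (∑-mono-≤ (f≤g ∘ Fin.suc))

sum-*-sum : ∀ {m n} (f : Fin m → ℤ) (g : Fin n → ℤ) →
            sum f * sum g ≡ ∑[ i < m ] ∑[ j < n ] (f i * g j)
sum-*-sum f g = trans (*-distribʳ-sum (sum g) f) (sum-cong-≗ λ i → *-distribˡ-sum (f i) g)

partialSum : (ℕ → ℤ) → ℕ → ℤ
partialSum f n = ∑[ i < n ] f (toℕ i)

partialSum-suc : ∀ (f : ℕ → ℤ) n → partialSum f (suc n) ≡ partialSum f n + f n
partialSum-suc f zero    = ℤP.+-comm (f 0) (+ 0)
partialSum-suc f (suc n) = trans (cong (_+_ (f 0)) (partialSum-suc (λ m → f (suc m)) n))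
                                 (sym (ℤP.+-assoc (f 0) _ _))

partialSum-reverse : ∀ (f : ℕ → ℤ) n → partialSum (λ m → f (n ∸ m)) n ≡ partialSum (λ m → f (suc m)) n
partialSum-reverse f zero    = refl
partialSum-reverse f (suc n) = begin
  f (suc n) + partialSum (λ m → f (n ∸ m)) n    ≡⟨ cong (_+_ (f (suc n))) (partialSum-reverse f n) ⟩
  f (suc n) + partialSum (λ m → f (suc m)) n    ≡⟨ ℤP.+-comm (f (suc n)) _ ⟩
  partialSum (λ m → f (suc m)) n + f (suc n)    ≡⟨ partialSum-suc (λ m → f (suc m)) n ⟨
  partialSum (λ m → f (suc m)) (suc n)          ∎
  where open ≡-Reasoning

Periodic : ℕ → (ℕ → ℤ) → Set
Periodic n F = ∀ m → F (m ℕ.+ n) ≡ F m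

periodic-+ˡ : ∀ {n F} → Periodic n F → ∀ t → Periodic n (λ m → F (t ℕ.+ m))
periodic-+ˡ {n} {F} per t m = trans (cong F (sym (ℕP.+-assoc t m n))) (per (t ℕ.+ m))

periodic-* : ∀ {n F G} → Periodic n F → Periodic n G → Periodic n (λ m → F m * G m)
periodic-* perF perG m = cong₂ _*_ (perF m) (perG m)

module _ {n : ℕ} {F : ℕ → ℤ} (per : Periodic n F) where

  partialSum-shift₁ : partialSum (λ m → F (suc m)) n ≡ partialSum F n
  partialSum-shift₁ = ∙-cancelˡ (F 0) _ _ (begin
    F 0 + partialSum (λ m → F (suc m)) n  ≡⟨ partialSum-suc F n ⟩
    partialSum F n + F n                  ≡⟨ cong (_+_ (partialSum F n)) (per 0) ⟩
    partialSum F n + F 0                  ≡⟨ ℤP.+-comm (partialSum F n) (F 0) ⟩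
    F 0 + partialSum F n                  ∎)
    where open ≡-Reasoning

  partialSum-reflect : partialSum (λ m → F (n ∸ m)) n ≡ partialSum F n
  partialSum-reflect = trans (partialSum-reverse F n) partialSum-shift₁

partialSum-shift : ∀ {n F} → Periodic n F → ∀ t → partialSum (λ m → F (t ℕ.+ m)) n ≡ partialSum F n
partialSum-shift per zero    = refl
partialSum-shift per (suc t) =
  trans (partialSum-shift (per ∘ suc) t) (partialSum-shift₁ per)

gram : ∀ {m n} → (Fin m → Fin n → ℤ) → Fin n → Fin n → ℤ
gram {m} A c d = ∑[ r < m ] (A r c * A r d)

gram-sym : ∀ {m n} (A : Fin m → Fin n → ℤ) c d → gram A c d ≡ gram A d c
gram-sym {m} A c d = sum-cong-≗ λ (r : Fin m) → ℤP.*-comm (A r c) (A r d)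

gram-rowSum : ∀ {m n} (A : Fin m → Fin n → ℤ) S →
              (∀ r → ∑[ c < n ] A r c ≡ S) → (∀ c → ∑[ r < m ] A r c ≡ S) →
              ∀ c → ∑[ d < n ] gram A c d ≡ S * S
gram-rowSum {m} {n} A S rowSum colSum c = begin
  ∑[ d < n ] ∑[ r < m ] (A r c * A r d)  ≡⟨ ∑-comm (λ d r → A r c * A r d) ⟩
  ∑[ r < m ] ∑[ d < n ] (A r c * A r d)  ≡⟨ sum-cong-≗ (λ r → *-distribˡ-sum (A r c) (A r)) ⟨
  ∑[ r < m ] (A r c * ∑[ d < n ] A r d)  ≡⟨ sum-cong-≗ (λ r → cong (A r c *_) (rowSum r)) ⟩
  ∑[ r < m ] (A r c * S)                 ≡⟨ *-distribʳ-sum S (λ r → A r c) ⟨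
  (∑[ r < m ] A r c) * S                 ≡⟨ cong (_* S) (colSum c) ⟩
  S * S                                  ∎
  where open ≡-Reasoning

quadraticForm : ∀ {n} → (Fin n → Fin n → ℤ) → (Fin n → ℤ) → ℤ
quadraticForm {n} M x = ∑[ c < n ] ∑[ d < n ] (x c * x d * M c d)

‖·ᵥ‖²≡quadraticForm-gram : ∀ {n} (A : Fin n → Fin n → ℤ) x → ‖ A ·ᵥ x ‖² ≡ quadraticForm (gram A) x
‖·ᵥ‖²≡quadraticForm-gram {n} A x = begin
  ‖ A ·ᵥ x ‖²
    ≡⟨ trans (∑≡sum n _) (sum-cong-≗ λ r → cong₂ _*_ (∑≡sum n (λ c → A r c * x c)) (∑≡sum n (λ d → A r d * x d))) ⟩
  ∑[ r < n ] (∑[ c < n ] (A r c * x c) * ∑[ d < n ] (A r d * x d))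
    ≡⟨ sum-cong-≗ (λ r → sum-*-sum (λ c → A r c * x c) (λ d → A r d * x d)) ⟩
  ∑[ r < n ] ∑[ c < n ] ∑[ d < n ] (A r c * x c * (A r d * x d))
    ≡⟨ ∑-comm (λ r c → ∑[ d < n ] (A r c * x c * (A r d * x d))) ⟩
  ∑[ c < n ] ∑[ r < n ] ∑[ d < n ] (A r c * x c * (A r d * x d))
    ≡⟨ sum-cong-≗ (λ c → ∑-comm (λ r d → A r c * x c * (A r d * x d))) ⟩
  ∑[ c < n ] ∑[ d < n ] ∑[ r < n ] (A r c * x c * (A r d * x d))
    ≡⟨ sum-cong-≗ (λ c → sum-cong-≗ λ d → trans (sum-cong-≗ λ r → regroup (A r c) (x c) (A r d) (x d))
                                               (sym (*-distribˡ-sum (x c * x d) (λ r → A r c * A r d)))) ⟩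
  quadraticForm (gram A) x
    ∎
  where
  open ≡-Reasoning
  regroup : ∀ a u b v → a * u * (b * v) ≡ u * v * (a * b)
  regroup = solve-∀

+∣i∣*+∣i∣≡i*i : ∀ i → + ∣ i ∣ * + ∣ i ∣ ≡ i * i
+∣i∣*+∣i∣≡i*i (+ n)    = refl
+∣i∣*+∣i∣≡i*i -[1+ n ] = refl

0≤i*i : ∀ i → + 0 ≤ i * i
0≤i*i i = subst (+ 0 ≤_) (trans (ℤP.pos-* ∣ i ∣ ∣ i ∣) (+∣i∣*+∣i∣≡i*i i)) (+≤+ z≤n)

2ij≤i*i+j*j : ∀ i j → + 2 * (i * j) ≤ i * i + j * j
2ij≤i*i+j*j i j = subst₂ _≤_ (ℤP.+-identityʳ (+ 2 * (i * j))) (sym (expand i j))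
  (ℤP.+-monoʳ-≤ (+ 2 * (i * j)) (0≤i*i (i - j)))
  where
  expand : ∀ i j → i * i + j * j ≡ + 2 * (i * j) + (i - j) * (i - j)
  expand = solve-∀

∑∑-weighted-rowSum : ∀ {m n} (M : Fin m → Fin n → ℤ) s (w : Fin m → ℤ) →
                     (∀ c → ∑[ d < n ] M c d ≡ s) →
                     ∑[ c < m ] ∑[ d < n ] (w c * M c d) ≡ s * sum w
∑∑-weighted-rowSum M s w rowSum = begin
  ∑[ c < _ ] ∑[ d < _ ] (w c * M c d)  ≡⟨ sum-cong-≗ (λ c → *-distribˡ-sum (w c) (M c)) ⟨
  ∑[ c < _ ] (w c * sum (M c))         ≡⟨ sum-cong-≗ (λ c → trans (cong (w c *_) (rowSum c)) (ℤP.*-comm (w c) s)) ⟩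
  ∑[ c < _ ] (s * w c)                 ≡⟨ *-distribˡ-sum s w ⟨
  s * sum w                            ∎
  where open ≡-Reasoning

quadraticForm-≤ : ∀ {n} (M : Fin n → Fin n → ℤ) s → (∀ c d → + 0 ≤ M c d) →
                  (∀ c → ∑[ d < n ] M c d ≡ s) → (∀ d → ∑[ c < n ] M c d ≡ s) →
                  ∀ x → quadraticForm M x ≤ s * ∑[ c < n ] (x c * x c)
quadraticForm-≤ {n} M s M≥0 rowSum colSum x = ℤP.*-cancelˡ-≤-pos _ _ (+ 2) (begin
  + 2 * quadraticForm M x
    ≡⟨ trans (*-distribˡ-sum (+ 2) (λ c → ∑[ d < n ] (x c * x d * M c d)))
             (sum-cong-≗ λ c → *-distribˡ-sum (+ 2) (λ d → x c * x d * M c d)) ⟩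
  ∑[ c < n ] ∑[ d < n ] (+ 2 * (x c * x d * M c d))
    ≤⟨ ∑-mono-≤ (λ c → ∑-mono-≤ (λ d → 2xyM≤[x²+y²]M c d)) ⟩
  ∑[ c < n ] ∑[ d < n ] (x c * x c * M c d + x d * x d * M c d)
    ≡⟨ trans (sum-cong-≗ λ c → ∑-distrib-+ (λ d → x c * x c * M c d) (λ d → x d * x d * M c d))
             (∑-distrib-+ (λ c → ∑[ d < n ] (x c * x c * M c d)) (λ c → ∑[ d < n ] (x d * x d * M c d))) ⟩
  ∑[ c < n ] ∑[ d < n ] (x c * x c * M c d) + ∑[ c < n ] ∑[ d < n ] (x d * x d * M c d)
    ≡⟨ cong₂ _+_ (∑∑-weighted-rowSum M s (λ c → x c * x c) rowSum)
                 (trans (∑-comm (λ c d → x d * x d * M c d))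
                        (∑∑-weighted-rowSum (λ d c → M c d) s (λ d → x d * x d) colSum)) ⟩
  s * T + s * T
    ≡⟨ double (s * T) ⟩
  + 2 * (s * T)
    ∎)
  where
  open ℤP.≤-Reasoning
  T = ∑[ c < n ] (x c * x c)
  double : ∀ i → i + i ≡ + 2 * i
  double = solve-∀
  2xyM≤[x²+y²]M : ∀ c d → + 2 * (x c * x d * M c d) ≤ x c * x c * M c d + x d * x d * M c d
  2xyM≤[x²+y²]M c d = begin
    + 2 * (x c * x d * M c d)          ≡⟨ ℤP.*-assoc (+ 2) (x c * x d) (M c d) ⟨
    + 2 * (x c * x d) * M c d          ≤⟨ ℤP.*-monoʳ-≤-nonNeg (M c d) {{nonNegative (M≥0 c d)}} (2ij≤i*i+j*j (x c) (x d)) ⟩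
    (x c * x c + x d * x d) * M c d    ≡⟨ ℤP.*-distribʳ-+ (M c d) (x c * x c) (x d * x d) ⟩
    x c * x c * M c d + x d * x d * M c d ∎

‖const1‖²≡n : ∀ n → ‖ (λ (_ : Fin n) → + 1) ‖² ≡ + n
‖const1‖²≡n zero    = refl
‖const1‖²≡n (suc n) = cong (_+_ (+ 1)) (‖const1‖²≡n n)

gram≥0⇒spectralNorm≡∣lineSum∣ :
  ∀ {n} .{{_ : NonZero n}} (A : Fin n → Fin n → ℤ) S →
  (∀ r → ∑[ c < n ] A r c ≡ S) → (∀ c → ∑[ r < n ] A r c ≡ S) →
  (∀ c d → + 0 ≤ gram A c d) → SpectralNormIs A ∣ S ∣
gram≥0⇒spectralNorm≡∣lineSum∣ {n} A S rowSum colSum gram≥0 =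
  bound , const1 , ‖const1‖²≢0 , attained
  where
  S² = + ∣ S ∣ * + ∣ S ∣

  gram-colSum : ∀ d → ∑[ c < n ] gram A c d ≡ S * S
  gram-colSum d = trans (sum-cong-≗ λ c → gram-sym A c d) (gram-rowSum A S rowSum colSum d)

  bound : ∀ x → ‖ A ·ᵥ x ‖² ≤ S² * ‖ x ‖²
  bound x = begin
    ‖ A ·ᵥ x ‖²                         ≡⟨ ‖·ᵥ‖²≡quadraticForm-gram A x ⟩
    quadraticForm (gram A) x            ≤⟨ quadraticForm-≤ (gram A) (S * S) gram≥0
                                             (gram-rowSum A S rowSum colSum) gram-colSum x ⟩
    S * S * ∑[ c < n ] (x c * x c)      ≡⟨ cong₂ _*_ (+∣i∣*+∣i∣≡i*i S) (∑≡sum n _) ⟨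
    S² * ‖ x ‖²                         ∎
    where open ℤP.≤-Reasoning

  const1 : Fin n → ℤ
  const1 _ = + 1

  ‖const1‖²≢0 : ‖ const1 ‖² ≢ + 0
  ‖const1‖²≢0 eq = ℕ.≢-nonZero⁻¹ n (ℤP.+-injective (trans (sym (‖const1‖²≡n n)) eq))

  A·const1≡S : ∀ r → (A ·ᵥ const1) r ≡ S
  A·const1≡S r = trans (∑≡sum n _) (trans (sum-cong-≗ λ c → ℤP.*-identityʳ (A r c)) (rowSum r))

  attained : ‖ A ·ᵥ const1 ‖² ≡ S² * ‖ const1 ‖²
  attained = begin
    ‖ A ·ᵥ const1 ‖²              ≡⟨ ∑≡sum n _ ⟩
    ∑[ r < n ] ((A ·ᵥ const1) r * (A ·ᵥ const1) r)
                                  ≡⟨ sum-cong-≗ (λ r → cong₂ _*_ (A·const1≡S r) (A·const1≡S r)) ⟩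
    ∑[ r < n ] (S * S)            ≡⟨ sum-cong-≗ (λ (r : Fin n) → ℤP.*-identityʳ (S * S)) ⟨
    ∑[ r < n ] (S * S * + 1)      ≡⟨ *-distribˡ-sum (S * S) const1 ⟨
    S * S * sum const1            ≡⟨ cong₂ _*_ (+∣i∣*+∣i∣≡i*i S) (∑≡sum n _) ⟨
    S² * ‖ const1 ‖²              ∎
    where open ≡-Reasoning

-- circulant n x r c unfolds to extend n x (toℕ c ℕ.+ (n ∸ toℕ r)).
extend : ∀ n .{{_ : NonZero n}} → (Fin n → ℤ) → ℕ → ℤ
extend n x m = x (fromℕ< (m%n<n m n))

autocorrelation : ∀ n .{{_ : NonZero n}} → (Fin n → ℤ) → ℕ → ℤ
autocorrelation n x k = partialSum (λ m → extend n x m * extend n x (m ℕ.+ k)) n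

module _ {n : ℕ} .{{_ : NonZero n}} (x : Fin n → ℤ) where

  extend-periodic : Periodic n (extend n x)
  extend-periodic m = cong x (fromℕ<-cong _ _ ([m+n]%n≡m%n m n) _ _)

  extend-toℕ : ∀ i → extend n x (toℕ i) ≡ x i
  extend-toℕ i = cong x (trans (fromℕ<-cong _ _ (m<n⇒m%n≡m (toℕ<n i)) _ (toℕ<n i))
                               (fromℕ<-toℕ i (toℕ<n i)))

  extend-+-% : ∀ m k → extend n x (m ℕ.+ k % n) ≡ extend n x (m ℕ.+ k)
  extend-+-% m k = cong x (fromℕ<-cong _ _ [m+k%n]%n≡[m+k]%n _ _)
    where
    open ≡-Reasoning
    [m+k%n]%n≡[m+k]%n : (m ℕ.+ k % n) % n ≡ (m ℕ.+ k) % n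
    [m+k%n]%n≡[m+k]%n = begin
      (m ℕ.+ k % n) % n          ≡⟨ %-distribˡ-+ m (k % n) n ⟩
      (m % n ℕ.+ k % n % n) % n  ≡⟨ cong (λ j → (m % n ℕ.+ j) % n) (m%n%n≡m%n k n) ⟩
      (m % n ℕ.+ k % n) % n      ≡⟨ %-distribˡ-+ m k n ⟨
      (m ℕ.+ k) % n              ∎

  partialSum-extend : ∀ t → partialSum (λ m → extend n x (t ℕ.+ m)) n ≡ sum x
  partialSum-extend t = trans (partialSum-shift extend-periodic t) (sum-cong-≗ extend-toℕ)

  autocorrelation-% : ∀ k → autocorrelation n x (k % n) ≡ autocorrelation n x k
  autocorrelation-% k = sum-cong-≗ λ (i : Fin n) → cong (extend n x (toℕ i) *_) (extend-+-% (toℕ i) k)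

  circulant-rowSum : ∀ r → ∑[ c < n ] circulant n x r c ≡ sum x
  circulant-rowSum r =
    trans (sum-cong-≗ λ (c : Fin n) → cong (extend n x) (ℕP.+-comm (toℕ c) (n ∸ toℕ r)))
          (partialSum-extend (n ∸ toℕ r))

  circulant-colSum : ∀ c → ∑[ r < n ] circulant n x r c ≡ sum x
  circulant-colSum c =
    trans (partialSum-reflect (periodic-+ˡ extend-periodic (toℕ c))) (partialSum-extend (toℕ c))

  circulant-gram : ∀ c d → gram (circulant n x) c d ≡ autocorrelation n x (toℕ d ℕ.+ (n ∸ toℕ c))
  circulant-gram c d = begin
    gram (circulant n x) c d
      ≡⟨ partialSum-reflect product-periodic ⟩
    partialSum (λ m → extend n x (c′ ℕ.+ m) * extend n x (d′ ℕ.+ m)) n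
      ≡⟨ partialSum-shift product-periodic t ⟨
    partialSum (λ m → extend n x (c′ ℕ.+ (t ℕ.+ m)) * extend n x (d′ ℕ.+ (t ℕ.+ m))) n
      ≡⟨ sum-cong-≗ (λ (i : Fin n) → cong₂ _*_ (c′+[t+m]≡m (toℕ i))
                                               (cong (extend n x) (d′+[t+m]≡m+[d′+t] (toℕ i)))) ⟩
    autocorrelation n x (d′ ℕ.+ t)
      ∎
    where
    open ≡-Reasoning
    c′ = toℕ c
    d′ = toℕ d
    t = n ∸ c′
    product-periodic : Periodic n (λ m → extend n x (c′ ℕ.+ m) * extend n x (d′ ℕ.+ m))
    product-periodic = periodic-* (periodic-+ˡ extend-periodic c′) (periodic-+ˡ extend-periodic d′)
    c′+[t+m]≡m : ∀ m → extend n x (c′ ℕ.+ (t ℕ.+ m)) ≡ extend n x m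
    c′+[t+m]≡m m = begin
      extend n x (c′ ℕ.+ (t ℕ.+ m))  ≡⟨ cong (extend n x) (ℕP.+-assoc c′ t m) ⟨
      extend n x (c′ ℕ.+ t ℕ.+ m)    ≡⟨ cong (λ j → extend n x (j ℕ.+ m)) (ℕP.m+[n∸m]≡n (ℕP.<⇒≤ (toℕ<n c))) ⟩
      extend n x (n ℕ.+ m)           ≡⟨ cong (extend n x) (ℕP.+-comm n m) ⟩
      extend n x (m ℕ.+ n)           ≡⟨ extend-periodic m ⟩
      extend n x m                   ∎
    d′+[t+m]≡m+[d′+t] : ∀ m → d′ ℕ.+ (t ℕ.+ m) ≡ m ℕ.+ (d′ ℕ.+ t)
    d′+[t+m]≡m+[d′+t] m = trans (sym (ℕP.+-assoc d′ t m)) (ℕP.+-comm (d′ ℕ.+ t) m)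

circulant-spectralNorm : ∀ n .{{_ : NonZero n}} (x : Fin n → ℤ) →
                         (∀ k → k ℕ.< n → + 0 ≤ autocorrelation n x k) →
                         SpectralNormIs (circulant n x) ∣ ∑ n x ∣
circulant-spectralNorm n x autocorrelation≥0 =
  subst (λ S → SpectralNormIs (circulant n x) ∣ S ∣) (sym (∑≡sum n x))
    (gram≥0⇒spectralNorm≡∣lineSum∣ (circulant n x) (sum x)
      (circulant-rowSum x) (circulant-colSum x) gram≥0)
  where
  gram≥0 : ∀ c d → + 0 ≤ gram (circulant n x) c d
  gram≥0 c d = subst (+ 0 ≤_) (trans (autocorrelation-% x lag) (sym (circulant-gram x c d)))
                     (autocorrelation≥0 (lag % n) (m%n<n lag n))
    where lag = toℕ d ℕ.+ (n ∸ toℕ c)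

autocorrelation-toℕ : ∀ n .{{_ : NonZero n}} (f : ℕ → ℤ) k →
  ∑ n (λ i → f (toℕ i) * f ((toℕ i ℕ.+ suc k ∸ 1) % n)) ≡ autocorrelation n (λ i → f (toℕ i)) k
autocorrelation-toℕ n f k = trans (∑≡sum n _) (sum-cong-≗ λ (i : Fin n) →
  cong₂ _*_ (sym (extend-toℕ (λ i → f (toℕ i)) i))
            (cong f (trans (cong (λ j → (j ∸ 1) % n) (ℕP.+-suc (toℕ i) k))
                           (sym (toℕ-fromℕ< (m%n<n (toℕ i ℕ.+ k) n))))))

module _ (a b p q : ℤ) where
  private
    h : ℕ → ℤ
    h = hseq a b p q

  partialSum-hseq : ∀ k → (p + q - + 1) * partialSum h (suc k) ≡ h (suc k) + q * h k + (p - + 1) * a - b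
  partialSum-hseq zero    = base a b p q
    where
    base : ∀ a b p q → (p + q - + 1) * (a + + 0) ≡ b + q * a + (p - + 1) * a - b
    base = solve-∀
  partialSum-hseq (suc k) = begin
    (p + q - + 1) * partialSum h (suc (suc k))
      ≡⟨ cong ((p + q - + 1) *_) (partialSum-suc h (suc k)) ⟩
    (p + q - + 1) * (partialSum h (suc k) + y)
      ≡⟨ ℤP.*-distribˡ-+ (p + q - + 1) (partialSum h (suc k)) y ⟩
    (p + q - + 1) * partialSum h (suc k) + (p + q - + 1) * y
      ≡⟨ cong (_+ ((p + q - + 1) * y)) (partialSum-hseq k) ⟩
    y + q * z + (p - + 1) * a - b + (p + q - + 1) * y
      ≡⟨ regroup a b p q y z ⟩
    (p * y + q * z) + q * y + (p - + 1) * a - b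
      ∎
    where
    open ≡-Reasoning
    y = h (suc k)
    z = h k
    regroup : ∀ a b p q y z → y + q * z + (p - + 1) * a - b + (p + q - + 1) * y
                            ≡ (p * y + q * z) + q * y + (p - + 1) * a - b
    regroup = solve-∀

  module _ (p+q≡1 : p + q ≡ + 1) where

    hseq-invariant : ∀ k → h (suc k) + q * h k ≡ q * a + b
    hseq-invariant zero    = ℤP.+-comm b (q * a)
    hseq-invariant (suc k) = begin
      p * y + q * z + q * y  ≡⟨ regroup p q y z ⟩
      (p + q) * y + q * z    ≡⟨ cong (λ s → s * y + q * z) p+q≡1 ⟩
      + 1 * y + q * z        ≡⟨ cong (_+ (q * z)) (ℤP.*-identityˡ y) ⟩
      y + q * z              ≡⟨ hseq-invariant k ⟩
      q * a + b              ∎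
      where
      open ≡-Reasoning
      y = h (suc k)
      z = h k
      regroup : ∀ p q y z → p * y + q * z + q * y ≡ (p + q) * y + q * z
      regroup = solve-∀

    partialSum-hseq-p+q≡1 : ∀ k → (q + + 1) * partialSum h (suc k) ≡ q * h k + + k * (q * a + b) + a
    partialSum-hseq-p+q≡1 zero    = base a b q
      where
      base : ∀ a b q → (q + + 1) * (a + + 0) ≡ q * a + + 0 * (q * a + b) + a
      base = solve-∀
    partialSum-hseq-p+q≡1 (suc k) = begin
      (q + + 1) * partialSum h (suc (suc k))
        ≡⟨ cong ((q + + 1) *_) (partialSum-suc h (suc k)) ⟩
      (q + + 1) * (partialSum h (suc k) + y)
        ≡⟨ ℤP.*-distribˡ-+ (q + + 1) (partialSum h (suc k)) y ⟩
      (q + + 1) * partialSum h (suc k) + (q + + 1) * y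
        ≡⟨ cong (_+ ((q + + 1) * y)) (partialSum-hseq-p+q≡1 k) ⟩
      q * z + + k * (q * a + b) + a + (q + + 1) * y
        ≡⟨ cong (λ w → q * z + + k * w + a + (q + + 1) * y) (hseq-invariant k) ⟨
      q * z + + k * (y + q * z) + a + (q + + 1) * y
        ≡⟨ regroup q a y z (+ k) ⟩
      q * y + (+ 1 + + k) * (y + q * z) + a
        ≡⟨ cong (λ w → q * y + (+ 1 + + k) * w + a) (hseq-invariant k) ⟩
      q * y + + suc k * (q * a + b) + a
        ∎
      where
      open ≡-Reasoning
      y = h (suc k)
      z = h k
      regroup : ∀ q a y z k → q * z + k * (y + q * z) + a + (q + + 1) * y
                              ≡ q * y + (+ 1 + k) * (y + q * z) + a
      regroup = solve-∀

hseq-arithmetic : ∀ a b k → hseq a b (+ 2) (- + 1) k ≡ a + + k * (b - a)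
hseq-arithmetic a b zero          = base a b
  where
  base : ∀ a b → a ≡ a + + 0 * (b - a)
  base = solve-∀
hseq-arithmetic a b (suc zero)    = base a b
  where
  base : ∀ a b → b ≡ a + + 1 * (b - a)
  base = solve-∀
hseq-arithmetic a b (suc (suc k)) = begin
  + 2 * hseq a b (+ 2) (- + 1) (suc k) + - + 1 * hseq a b (+ 2) (- + 1) k
    ≡⟨ cong₂ (λ u v → + 2 * u + - + 1 * v) (hseq-arithmetic a b (suc k)) (hseq-arithmetic a b k) ⟩
  + 2 * (a + (+ 1 + + k) * (b - a)) + - + 1 * (a + + k * (b - a))
    ≡⟨ regroup a (b - a) (+ k) ⟩
  a + (+ 1 + (+ 1 + + k)) * (b - a)
    ∎
  where
  open ≡-Reasoning
  regroup : ∀ a d k → + 2 * (a + (+ 1 + k) * d) + - + 1 * (a + k * d) ≡ a + (+ 1 + (+ 1 + k)) * d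
  regroup = solve-∀

partialSum-arithmetic : ∀ a d k → + 2 * partialSum (λ i → a + + i * d) (suc k) ≡ + suc k * (a + + k * d + a)
partialSum-arithmetic a d zero    = base a d
  where
  base : ∀ a d → + 2 * (a + + 0 * d + + 0) ≡ + 1 * (a + + 0 * d + a)
  base = solve-∀
partialSum-arithmetic a d (suc k) = begin
  + 2 * partialSum f (suc (suc k))
    ≡⟨ cong (+ 2 *_) (partialSum-suc f (suc k)) ⟩
  + 2 * (partialSum f (suc k) + f (suc k))
    ≡⟨ ℤP.*-distribˡ-+ (+ 2) (partialSum f (suc k)) (f (suc k)) ⟩
  + 2 * partialSum f (suc k) + + 2 * f (suc k)
    ≡⟨ cong (_+ (+ 2 * f (suc k))) (partialSum-arithmetic a d k) ⟩
  (+ 1 + + k) * (a + + k * d + a) + + 2 * (a + (+ 1 + + k) * d)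
    ≡⟨ regroup a d (+ k) ⟩
  (+ 1 + (+ 1 + + k)) * (a + (+ 1 + + k) * d + a)
    ∎
  where
  open ≡-Reasoning
  f : ℕ → ℤ
  f i = a + + i * d
  regroup : ∀ a d k → (+ 1 + k) * (a + k * d + a) + + 2 * (a + (+ 1 + k) * d)
                      ≡ (+ 1 + (+ 1 + k)) * (a + (+ 1 + k) * d + a)
  regroup = solve-∀

partialSum-hseq-arithmetic : ∀ a b k → + 2 * partialSum (hseq a b (+ 2) (- + 1)) (suc k)
                                ≡ + suc k * (hseq a b (+ 2) (- + 1) k + a)
partialSum-hseq-arithmetic a b k = begin
  + 2 * partialSum (hseq a b (+ 2) (- + 1)) (suc k)
    ≡⟨ cong (+ 2 *_) (sum-cong-≗ λ (i : Fin (suc k)) → hseq-arithmetic a b (toℕ i)) ⟩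
  + 2 * partialSum (λ i → a + + i * (b - a)) (suc k)
    ≡⟨ partialSum-arithmetic a (b - a) k ⟩
  + suc k * (a + + k * (b - a) + a)
    ≡⟨ cong (λ v → + suc k * (v + a)) (hseq-arithmetic a b k) ⟨
  + suc k * (hseq a b (+ 2) (- + 1) k + a)
    ∎
  where open ≡-Reasoning

corollary3 : (a b p q : ℤ) (n : ℕ) {{_ : NonZero n}} →
  (∀ (j : ℕ) → 1 ℕ.≤ j → j ℕ.≤ n →
    + 0 ≤ ∑ n (λ i → hseq a b p q (toℕ i) * hseq a b p q ((toℕ i ℕ.+ j ∸ 1) % n))) →
  SpectralNormIs (circulant n (λ i → hseq a b p q (toℕ i))) ∣ ∑ n (λ i → hseq a b p q (toℕ i)) ∣
  × (p + q ≢ + 1 →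
      (p + q - + 1) * ∑ n (λ i → hseq a b p q (toℕ i))
        ≡ hseq a b p q n + q * hseq a b p q (n ∸ 1) + (p - + 1) * a - b)
  × (p + q ≡ + 1 → p ≢ + 2 →
      (q + + 1) * ∑ n (λ i → hseq a b p q (toℕ i))
        ≡ q * hseq a b p q (n ∸ 1) + (+ (n ∸ 1)) * (q * a + b) + a)
  × (p ≡ + 2 → q ≡ - + 1 →
      + 2 * ∑ n (λ i → hseq a b p q (toℕ i))
        ≡ (+ n) * (hseq a b p q (n ∸ 1) + a))
corollary3 _ _ _ _ zero {{()}} _
corollary3 a b p q n@(suc k) autocorrelation-hyp =
  circulant-spectralNorm n x autocorrelation≥0 ,
  (λ _ → trans (cong ((p + q - + 1) *_) (∑≡sum n x)) (partialSum-hseq a b p q k)) ,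
  (λ p+q≡1 _ → trans (cong ((q + + 1) *_) (∑≡sum n x)) (partialSum-hseq-p+q≡1 a b p q p+q≡1 k)) ,
  λ { refl refl → trans (cong (+ 2 *_) (∑≡sum n x)) (partialSum-hseq-arithmetic a b k) }
  where
  x : Fin n → ℤ
  x i = hseq a b p q (toℕ i)
  autocorrelation≥0 : ∀ j → j ℕ.< n → + 0 ≤ autocorrelation n x j
  autocorrelation≥0 j j<n = subst (+ 0 ≤_) (autocorrelation-toℕ n (hseq a b p q) j)
                                  (autocorrelation-hyp (suc j) (s≤s z≤n) j<n)
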